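{- Let $A$, $B$, $m$, $n$ be positive integers such that $m$ and $n$ are coprime. Let $I = \{0,\ldots,A\}\times\{0,\ldots,B\}$ and $S = \{am+bn : (a,b)\in I\}$. Then \[ |S| = \begin{cases} Am + Bn + 1 - (m-1)(n-1) & \text{if } A \ge n \text{ and } B \ge m,\\ (A+1)(B+1) & \text{otherwise.}\end{cases} \]
   Context: The paper writes $h = \tfrac12 (m-1)(n-1)$, so the first case reads $Am+Bn+1-2h$. -}

module Defs where

open import Data.Nat using (ℕ; _+_; _*_; _∸_; _≤_; _≤?_)
open import Data.Nat.Coprimality using (Coprime)
open import Data.Product using (∃-syntax; _×_)
open import Relation.Binary.PropositionalEquality using (_≡_)
open import Relation.Nullary using (yes; no)
open import Data.Bool using (if_then_else_)
open import Relation.Nullary.Decidable using (⌊_⌋)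
open import Data.Bool using (_∧_)

InS : (A B m n k : ℕ) → Set
InS A B m n k = ∃[ a ] ∃[ b ] (a ≤ A × b ≤ B × k ≡ a * m + b * n)

-- the claimed value of |S|
-- (in the first case, Am+Bn+1 > (m-1)(n-1), so truncated subtraction is exact)
sizeS : (A B m n : ℕ) → ℕ
sizeS A B m n =
  if ⌊ n ≤? A ⌋ ∧ ⌊ m ≤? B ⌋
  then A * m + B * n + 1 ∸ (m ∸ 1) * (n ∸ 1)
  else (A + 1) * (B + 1)

-- Call (a, b) ∈ I canonical when a < n or b + m > B, i.e. when the exchange
-- (a, b) ↦ (a − n, b + m), which preserves am + bn, would leave I. Repeated
-- exchanges turn any (a, b) ∈ I into a canonical pair with the same value, and
-- two pairs with the same value differ by a multiple of (n, −m) because m and n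
-- are coprime, so distinct canonical pairs have distinct values. Hence |S| is the
-- number of canonical pairs: the B − m + 1 rows b with b + m ≤ B contain
-- min(n, A + 1) of them, every other row contains A + 1.
module Submission where

open import Defs
open import Data.Nat using (ℕ; _<_)
open import Data.Nat.Coprimality using (Coprime)
open import Data.Product using (∃-syntax; _×_)
open import Data.List using (List; length)
open import Data.List.Relation.Unary.Unique.Propositional using (Unique)
open import Data.List.Membership.Propositional using (_∈_)
open import Function.Bundles using (_⇔_)
open import Relation.Binary.PropositionalEquality using (_≡_)

open import Data.Bool using (if_then_else_; _∧_)
open import Data.Empty using (⊥)
open import Data.List using ([]; _∷_; _++_; applyUpTo)
open import Data.List.Membership.Propositional.Properties using (++-∈⇔; ∈-applyUpTo⁺; ∈-applyUpTo⁻)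
open import Data.List.Relation.Unary.AllPairs using ([])
open import Data.List.Properties using (length-++; length-applyUpTo)
open import Data.List.Relation.Unary.Unique.Propositional.Properties using (++⁺; applyUpTo⁺₁)
open import Data.Nat using (zero; suc; _+_; _*_; _∸_; _⊓_; _≤_; _≤?_; s≤s; NonZero; >-nonZero; >-nonZero⁻¹)
open import Data.Nat.Coprimality using (coprime-divisor) renaming (sym to coprime-sym)
open import Data.Nat.Divisibility using (divides; ∣⇒≤)
open import Data.Nat.Induction using (<-rec)
open import Data.Nat.Properties
open import Data.Nat.Tactic.RingSolver using (solve-∀; solve)
open import Data.Product using (_,_)
open import Data.Sum using (_⊎_; inj₁; inj₂)
open import Data.Sum.Function.Propositional using (_⊎-⇔_)
open import Function.Bundles using (mk⇔; Equivalence)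
import Function.Properties.Equivalence as ⇔
open import Relation.Binary.PropositionalEquality using (refl; sym; trans; cong; cong₂; subst; module ≡-Reasoning)
open import Relation.Nullary using (¬_; Dec; yes; no; contradiction)
open import Relation.Nullary.Decidable using (⌊_⌋)

open Equivalence using (to; from)

_HasSize_ : {X : Set} → (X → Set) → ℕ → Set
P HasSize N = ∃[ xs ] (Unique xs × (∀ x → (x ∈ xs) ⇔ P x) × length xs ≡ N)

sumBelow : ℕ → (ℕ → ℕ) → ℕ
sumBelow zero    f = 0
sumBelow (suc c) f = sumBelow c f + f c

sumBelow-constant : ∀ c {f x} → (∀ i → i < c → f i ≡ x) → sumBelow c f ≡ c * x
sumBelow-constant zero    f≡x = refl
sumBelow-constant (suc c) {f} {x} f≡x = begin
  sumBelow c f + f c ≡⟨ cong₂ _+_ (sumBelow-constant c (λ i i<c → f≡x i (m<n⇒m<1+n i<c))) (f≡x c ≤-refl) ⟩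
  c * x + x          ≡⟨ +-comm (c * x) x ⟩
  suc c * x          ∎
  where open ≡-Reasoning

sumBelow-+ : ∀ c d f → sumBelow (c + d) f ≡ sumBelow c f + sumBelow d (λ i → f (c + i))
sumBelow-+ c zero    f = trans (cong (λ c → sumBelow c f) (+-identityʳ c)) (sym (+-identityʳ _))
sumBelow-+ c (suc d) f = begin
  sumBelow (c + suc d) f                                 ≡⟨ cong (λ c → sumBelow c f) (+-suc c d) ⟩
  sumBelow (c + d) f + f (c + d)                         ≡⟨ cong (_+ f (c + d)) (sumBelow-+ c d f) ⟩
  sumBelow c f + sumBelow d (λ i → f (c + i)) + f (c + d) ≡⟨ +-assoc (sumBelow c f) _ _ ⟩
  sumBelow c f + sumBelow (suc d) (λ i → f (c + i))       ∎
  where open ≡-Reasoning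

module _ {X : Set} where

  HasSize-resp : {P Q : X → Set} {N : ℕ} → (∀ x → P x ⇔ Q x) → P HasSize N → Q HasSize N
  HasSize-resp P⇔Q (xs , unique , ∈⇔P , length≡) = xs , unique , (λ x → ⇔.trans (∈⇔P x) (P⇔Q x)) , length≡

  HasSize-⊎ : {P Q : X → Set} {N M : ℕ} → (∀ {x} → P x → Q x → ⊥) →
              P HasSize N → Q HasSize M → (λ x → P x ⊎ Q x) HasSize (N + M)
  HasSize-⊎ disjoint (xs , unique-xs , ∈xs⇔P , length-xs) (ys , unique-ys , ∈ys⇔Q , length-ys) =
    xs ++ ys ,
    ++⁺ unique-xs unique-ys (λ (x∈xs , x∈ys) → disjoint (to (∈xs⇔P _) x∈xs) (to (∈ys⇔Q _) x∈ys)) ,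
    (λ x → ⇔.trans ++-∈⇔ (∈xs⇔P x ⊎-⇔ ∈ys⇔Q x)) ,
    trans (length-++ xs) (cong₂ _+_ length-xs length-ys)

  HasSize-⋃ : (P : ℕ → X → Set) (size : ℕ → ℕ) (c : ℕ) →
              (∀ {i j x} → i < j → j < c → P i x → P j x → ⊥) →
              (∀ i → i < c → P i HasSize size i) →
              (λ x → ∃[ i ] (i < c × P i x)) HasSize sumBelow c size
  HasSize-⋃ P size zero    _        _     = [] , [] , (λ x → mk⇔ (λ ()) (λ ())) , refl
  HasSize-⋃ P size (suc c) disjoint sized =
    HasSize-resp lastRow
      (HasSize-⊎ (λ (i , i<c , Pix) → disjoint i<c ≤-refl Pix)
        (HasSize-⋃ P size c (λ i<j j<c → disjoint i<j (m<n⇒m<1+n j<c)) (λ i i<c → sized i (m<n⇒m<1+n i<c)))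
        (sized c ≤-refl))
    where
    lastRow : ∀ x → ((∃[ i ] (i < c × P i x)) ⊎ P c x) ⇔ (∃[ i ] (i < suc c × P i x))
    lastRow x = mk⇔ (λ { (inj₁ (i , i<c , Pix)) → i , m<n⇒m<1+n i<c , Pix
                       ; (inj₂ Pcx)            → c , ≤-refl , Pcx })
                    (λ (i , i<1+c , Pix) → split i<1+c Pix)
      where
      split : ∀ {i} → i < suc c → P i x → (∃[ i ] (i < c × P i x)) ⊎ P c x
      split i<1+c Pix with m<1+n⇒m<n∨m≡n i<1+c
      ... | inj₁ i<c  = inj₁ (_ , i<c , Pix)
      ... | inj₂ refl = inj₂ Pix

  HasSize-image : (f : ℕ → X) (l : ℕ) → (∀ {i j} → i < j → j < l → f i ≡ f j → ⊥) →
                  (λ x → ∃[ i ] (i < l × x ≡ f i)) HasSize l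
  HasSize-image f l injective =
    applyUpTo f l ,
    applyUpTo⁺₁ f l injective ,
    (λ x → mk⇔ (∈-applyUpTo⁻ f) (λ { (i , i<l , refl) → ∈-applyUpTo⁺ f i<l })) ,
    length-applyUpTo f l

exchange : ∀ x m n b → (x + n) * m + b * n ≡ x * m + (b + m) * n
exchange = solve-∀

coprime-balance : ∀ {m n d e} .{{_ : NonZero n}} .{{_ : NonZero d}} → Coprime m n →
                  e * m ≡ d * n → m ≤ d × n ≤ e
coprime-balance {m} {n} {d} {e} coprime em≡dn =
  ∣⇒≤ (coprime-divisor coprime (divides e (trans (*-comm n d) (sym em≡dn)))) ,
  ∣⇒≤ {{e≢0}} (coprime-divisor (coprime-sym coprime) (divides d (trans (*-comm m e) em≡dn)))
  where
  e≢0 : NonZero e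
  e≢0 = m*n≢0⇒m≢0 e {{subst NonZero (sym em≡dn) (m*n≢0 d n)}}

coprime-collision : ∀ {m n a b a′ b′} .{{_ : NonZero m}} .{{_ : NonZero n}} → Coprime m n → b < b′ →
                    a * m + b * n ≡ a′ * m + b′ * n → b + m ≤ b′ × a′ + n ≤ a
coprime-collision {m} {n} {a} {b} {a′} coprime b<b′ same
  with d , refl ← m≤n⇒∃[o]m+o≡n b<b′
  with am≡a′m+dn ← +-cancelʳ-≡ (b * n) (a * m) (a′ * m + suc d * n)
                     (trans same (solve (a′ ∷ m ∷ b ∷ d ∷ n ∷ [])))
  with e , refl ← m≤n⇒∃[o]m+o≡n (*-cancelʳ-≤ a′ a m (subst (a′ * m ≤_) (sym am≡a′m+dn) (m≤m+n _ _)))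
  = let m≤d , n≤e = coprime-balance {d = suc d} coprime
                      (+-cancelˡ-≡ (a′ * m) _ _ (trans (sym (*-distribʳ-+ m a′ e)) am≡a′m+dn))
    in ≤-trans (+-monoʳ-≤ b m≤d) (≤-reflexive (+-suc b d)) , +-monoʳ-≤ a′ n≤e

count-identity : ∀ A B m n .{{_ : NonZero m}} .{{_ : NonZero n}} → m ≤ B →
                 suc (B ∸ m) * n + m * suc A ≡ A * m + B * n + 1 ∸ (m ∸ 1) * (n ∸ 1)
count-identity A B (suc m) (suc n) 1+m≤B = begin
  suc C * suc n + suc m * suc A                        ≡⟨ m+n∸m≡n (m * n) _ ⟨
  m * n + (suc C * suc n + suc m * suc A) ∸ m * n      ≡⟨ cong (_∸ m * n) (expand A C m n) ⟩
  A * suc m + (C + suc m) * suc n + 1 ∸ m * n          ≡⟨ cong (λ b → A * suc m + b * suc n + 1 ∸ m * n) (m∸n+n≡m 1+m≤B) ⟩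
  A * suc m + B * suc n + 1 ∸ m * n                    ∎
  where
  open ≡-Reasoning
  C = B ∸ suc m
  expand : ∀ A C m n → m * n + (suc C * suc n + suc m * suc A) ≡ A * suc m + (C + suc m) * suc n + 1
  expand = solve-∀

module CanonicalPairs (A B m n : ℕ) .{{_ : NonZero m}} .{{_ : NonZero n}} (coprime : Coprime m n) where

  Canonical : ℕ → ℕ → Set
  Canonical a b = a ≤ A × b ≤ B × (b + m ≤ B → a < n)

  HasCanonicalForm : ℕ → ℕ → Set
  HasCanonicalForm a b = ∃[ a′ ] ∃[ b′ ] (Canonical a′ b′ × a * m + b * n ≡ a′ * m + b′ * n)

  canonical-representative : ∀ a b → a ≤ A → b ≤ B → HasCanonicalForm a b
  canonical-representative = <-rec _ reduce
    where
    reduce : ∀ a → (∀ {a′} → a′ < a → ∀ b → a′ ≤ A → b ≤ B → HasCanonicalForm a′ b) →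
             ∀ b → a ≤ A → b ≤ B → HasCanonicalForm a b
    reduce a rec b a≤A b≤B with b + m ≤? B | n ≤? a
    ... | yes b+m≤B | yes n≤a =
      let a′ , b′ , canonical , same =
            rec (∸-monoʳ-< (>-nonZero⁻¹ n) n≤a) (b + m) (≤-trans (m∸n≤m a n) a≤A) b+m≤B
      in a′ , b′ , canonical ,
         trans (trans (cong (λ a → a * m + b * n) (sym (m∸n+n≡m n≤a))) (exchange (a ∸ n) m n b)) same
    ... | yes _     | no n≰a   = a , b , (a≤A , b≤B , λ _ → ≰⇒> n≰a) , refl
    ... | no b+m≰B  | _        = a , b , (a≤A , b≤B , λ b+m≤B → contradiction b+m≤B b+m≰B) , refl

  canonical-distinct : ∀ {a b a′ b′} → Canonical a b → b′ ≤ B → b < b′ → a * m + b * n ≡ a′ * m + b′ * n → ⊥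
  canonical-distinct {a′ = a′} (_ , _ , a<n) b′≤B b<b′ same =
    let b+m≤b′ , a′+n≤a = coprime-collision coprime b<b′ same
    in <⇒≱ (a<n (≤-trans b+m≤b′ b′≤B)) (≤-trans (m≤n+m n a′) a′+n≤a)

  rowLength : ℕ → ℕ
  rowLength b with b + m ≤? B
  ... | yes _ = n ⊓ suc A
  ... | no _  = suc A

  rowLength-short : ∀ {b} → b + m ≤ B → rowLength b ≡ n ⊓ suc A
  rowLength-short {b} b+m≤B with b + m ≤? B
  ... | yes _    = refl
  ... | no b+m≰B = contradiction b+m≤B b+m≰B

  rowLength-full : ∀ {b} → ¬ (b + m ≤ B) → rowLength b ≡ suc A
  rowLength-full {b} b+m≰B with b + m ≤? B
  ... | yes b+m≤B = contradiction b+m≤B b+m≰B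
  ... | no _      = refl

  rowLength-large-n : A < n → ∀ b → rowLength b ≡ suc A
  rowLength-large-n A<n b with b + m ≤? B
  ... | yes _ = m≥n⇒m⊓n≡n A<n
  ... | no _  = refl

  <rowLength⇔Canonical : ∀ {a b} → b ≤ B → a < rowLength b ⇔ Canonical a b
  <rowLength⇔Canonical {a} {b} b≤B with b + m ≤? B
  ... | yes b+m≤B = mk⇔ (λ a<n⊓1+A → ≤-pred (m<n⊓o⇒m<o n (suc A) a<n⊓1+A) , b≤B ,
                                     λ _ → m<n⊓o⇒m<n n (suc A) a<n⊓1+A)
                        (λ (a≤A , _ , a<n) → ⊓-pres-m< (a<n b+m≤B) (s≤s a≤A))
  ... | no b+m≰B  = mk⇔ (λ a<1+A → ≤-pred a<1+A , b≤B , λ b+m≤B → contradiction b+m≤B b+m≰B)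
                        (λ (a≤A , _ , _) → s≤s a≤A)

  Row : ℕ → ℕ → Set
  Row b k = ∃[ a ] (a < rowLength b × k ≡ a * m + b * n)

  InS⇔Row : ∀ k → InS A B m n k ⇔ (∃[ b ] (b < suc B × Row b k))
  InS⇔Row k = mk⇔
    (λ (a , b , a≤A , b≤B , k≡) →
       let a′ , b′ , canonical@(_ , b′≤B , _) , same = canonical-representative a b a≤A b≤B
       in b′ , s≤s b′≤B , a′ , from (<rowLength⇔Canonical b′≤B) canonical , trans k≡ same)
    (λ (b , b<1+B , a , a<len , k≡) →
       let a≤A , b≤B , _ = to (<rowLength⇔Canonical (≤-pred b<1+B)) a<len
       in a , b , a≤A , b≤B , k≡)

  S-HasSize-rowLengths : InS A B m n HasSize sumBelow (suc B) rowLength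
  S-HasSize-rowLengths =
    HasSize-resp (λ k → ⇔.sym (InS⇔Row k)) (HasSize-⋃ Row rowLength (suc B) disjoint sized)
    where
    disjoint : ∀ {i j k} → i < j → j < suc B → Row i k → Row j k → ⊥
    disjoint i<j j<1+B (a , a<len , k≡) (a′ , _ , k≡′) =
      canonical-distinct {a′ = a′} (to (<rowLength⇔Canonical (≤-trans (<⇒≤ i<j) (≤-pred j<1+B))) a<len)
                         (≤-pred j<1+B) i<j (trans (sym k≡) k≡′)
    sized : ∀ b → b < suc B → Row b HasSize rowLength b
    sized b _ = HasSize-image (λ a → a * m + b * n) (rowLength b)
                  (λ i<j _ same → <⇒≢ i<j (*-cancelʳ-≡ _ _ m (+-cancelʳ-≡ (b * n) _ _ same)))

  rowLengths-all-full : (∀ b → rowLength b ≡ suc A) → sumBelow (suc B) rowLength ≡ (A + 1) * (B + 1)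
  rowLengths-all-full full = begin
    sumBelow (suc B) rowLength ≡⟨ sumBelow-constant (suc B) (λ b _ → full b) ⟩
    suc B * suc A              ≡⟨ *-comm (suc B) (suc A) ⟩
    suc A * suc B              ≡⟨ cong₂ _*_ (+-comm 1 A) (+-comm 1 B) ⟩
    (A + 1) * (B + 1)          ∎
    where open ≡-Reasoning

  rowLengths-split : n ≤ A → m ≤ B → sumBelow (suc B) rowLength ≡ A * m + B * n + 1 ∸ (m ∸ 1) * (n ∸ 1)
  rowLengths-split n≤A m≤B = begin
    sumBelow (suc B) rowLength
      ≡⟨ cong (λ c → sumBelow c rowLength) C+m≡1+B ⟨
    sumBelow (suc C + m) rowLength
      ≡⟨ sumBelow-+ (suc C) m rowLength ⟩
    sumBelow (suc C) rowLength + sumBelow m (λ i → rowLength (suc C + i))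
      ≡⟨ cong₂ _+_ (sumBelow-constant (suc C) short) (sumBelow-constant m long) ⟩
    suc C * n + m * suc A
      ≡⟨ count-identity A B m n m≤B ⟩
    A * m + B * n + 1 ∸ (m ∸ 1) * (n ∸ 1)
      ∎
    where
    open ≡-Reasoning
    C = B ∸ m
    C+m≡1+B : suc C + m ≡ suc B
    C+m≡1+B = cong suc (m∸n+n≡m m≤B)
    short : ∀ i → i < suc C → rowLength i ≡ n
    short i i<1+C = trans (rowLength-short (subst (i + m ≤_) (m∸n+n≡m m≤B) (+-monoˡ-≤ m (≤-pred i<1+C))))
                          (m≤n⇒m⊓n≡m (m≤n⇒m≤1+n n≤A))
    long : ∀ i → i < m → rowLength (suc C + i) ≡ suc A
    long i _ = rowLength-full (<⇒≱ (subst (_≤ suc C + i + m) C+m≡1+B (+-monoˡ-≤ m (m≤m+n (suc C) i))))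

  rowLengths≡sizeS : sumBelow (suc B) rowLength ≡ sizeS A B m n
  rowLengths≡sizeS = byCases (n ≤? A) (m ≤? B)
    where
    byCases : (n≤?A : Dec (n ≤ A)) (m≤?B : Dec (m ≤ B)) → sumBelow (suc B) rowLength ≡
              (if ⌊ n≤?A ⌋ ∧ ⌊ m≤?B ⌋ then A * m + B * n + 1 ∸ (m ∸ 1) * (n ∸ 1) else (A + 1) * (B + 1))
    byCases (yes n≤A) (yes m≤B) = rowLengths-split n≤A m≤B
    byCases (yes _)   (no m≰B)  =
      rowLengths-all-full (λ b → rowLength-full (λ b+m≤B → m≰B (≤-trans (m≤n+m m b) b+m≤B)))
    byCases (no n≰A)  _         = rowLengths-all-full (rowLength-large-n (≰⇒> n≰A))

proposition1 : (A B m n : ℕ) → 0 < A → 0 < B → 0 < m → 0 < n → Coprime m n →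
    ∃[ xs ] (Unique xs × (∀ k → (k ∈ xs) ⇔ InS A B m n k) × length xs ≡ sizeS A B m n)
proposition1 A B m n _ _ 0<m 0<n coprime =
  subst (InS A B m n HasSize_) rowLengths≡sizeS S-HasSize-rowLengths
  where open CanonicalPairs A B m n {{>-nonZero 0<m}} {{>-nonZero 0<n}} coprime
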